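{- Let $\Gamma$ be a $1$-differential poset and consider the Markov chain on $\Gamma$ with transition probabilities $p_{x,y}=\frac{d(\varnothing,y)}{(r+1)\,d(\varnothing,x)}$ for $x\in\Gamma_r$, $x\nearrow y$. Let $u\le v$ have ranks $|u|=k$, $|v|=n$. Then the probability that the chain started at $u$ reaches $v$ is $$p(u,v)=\frac{k!}{n!}\,\frac{d(u,v)\,d(\varnothing,v)}{d(\varnothing,u)}.$$
   Context: A $1$-differential poset is a graded poset $\Gamma=\bigsqcup_{n\ge0}\Gamma_n$ with each $\Gamma_n$ finite, a unique minimal element $\varnothing$, no maximal elements, covering relation $x\nearrow y$ raising rank by one, such that (D1) for $u\ne v$ the number of elements covered by both equals the number covering both, and (D2) if $v$ covers exactly $k$ elements then it is covered by exactly $k+1$ elements. $d(u,v)$ is the number of saturated chains from $u$ to $v$. (The $p_{x,y}$ sum to $1$ over $y$, since $\sum_{y:x\nearrow y}d(\varnothing,y)=(r+1)d(\varnothing,x)$.) -}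

module Defs where

open import Data.Nat using (ℕ; zero; suc; _+_; _*_; _!)
open import Data.Nat.Properties using () renaming (_≟_ to _≟ℕ_)
open import Data.Fin using (Fin) renaming (_≟_ to _≟F_)
open import Data.Bool using (Bool; true; false; if_then_else_; _∧_)
open import Data.Product using (Σ; ∃; _,_; proj₁; proj₂)
open import Data.Product.Properties using (≡-dec)
open import Data.Integer using (+_)
open import Data.Rational using (ℚ; _/_) renaming (_+_ to _+ℚ_; _*_ to _*ℚ_; 0ℚ to 0ℚ; 1ℚ to 1ℚ)
open import Relation.Binary.PropositionalEquality using (_≡_; _≢_)
open import Relation.Nullary using (yes; no)

sumℕ : (n : ℕ) → (Fin n → ℕ) → ℕ
sumℕ zero    f = 0
sumℕ (suc n) f = f Fin.zero + sumℕ n (λ i → f (Fin.suc i))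

sumℚ : (n : ℕ) → (Fin n → ℚ) → ℚ
sumℚ zero    f = 0ℚ
sumℚ (suc n) f = f Fin.zero +ℚ sumℚ n (λ i → f (Fin.suc i))

count : (n : ℕ) → (Fin n → Bool) → ℕ
count n f = sumℕ n (λ i → if f i then 1 else 0)

-- a / b as a rational; b = 0 gives 0 (never used in a differential poset,
-- where all denominators are positive)
frac : ℕ → ℕ → ℚ
frac a zero    = 0ℚ
frac a (suc b) = (+ a) / suc b

-- A graded "Hasse diagram": Γ_n = Fin (size n), with covering relation
-- x ↗ y (x ∈ Γ_n, y ∈ Γ_(n+1)) given as a Boolean-valued relation.
record Graded : Set where
  field
    size  : ℕ → ℕ
    cover : ∀ {n} → Fin (size n) → Fin (size (suc n)) → Bool

  Elem : Set
  Elem = Σ ℕ (λ n → Fin (size n))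

  rank : Elem → ℕ
  rank = proj₁

  eqElem? : (u v : Elem) → Bool
  eqElem? u v with ≡-dec _≟ℕ_ _≟F_ u v
  ... | yes _ = true
  ... | no  _ = false

  data _≤Γ_ (u : Elem) : Elem → Set where
    ≤-refl : u ≤Γ u
    ≤-step : ∀ {n} {w : Fin (size n)} {y : Fin (size (suc n))} →
             u ≤Γ (n , w) → cover w y ≡ true → u ≤Γ (suc n , y)

  -- d(u,v) : number of saturated chains from u to v
  chains : Elem → (n : ℕ) → Fin (size n) → ℕ
  chains u zero y    = if eqElem? u (zero , y) then 1 else 0
  chains u (suc n) y = (if eqElem? u (suc n , y) then 1 else 0)
                       + sumℕ (size n) (λ w → chains u n w * (if cover w y then 1 else 0))

  d : Elem → Elem → ℕ
  d u (n , y) = chains u n y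

  downDeg : (n : ℕ) → Fin (size n) → ℕ
  downDeg zero    x = 0
  downDeg (suc n) x = count (size n) (λ w → cover w x)

  upDeg : (n : ℕ) → Fin (size n) → ℕ
  upDeg n x = count (size (suc n)) (λ y → cover x y)

  commonDown : (n : ℕ) → Fin (size n) → Fin (size n) → ℕ
  commonDown zero    u v = 0
  commonDown (suc n) u v = count (size n) (λ w → cover w u ∧ cover w v)

  commonUp : (n : ℕ) → Fin (size n) → Fin (size n) → ℕ
  commonUp n u v = count (size (suc n)) (λ y → cover u y ∧ cover v y)

record IsDifferential1 (Γ : Graded) : Set where
  open Graded Γ
  field
    ∅        : Fin (size 0)
    ∅-unique : ∀ (x : Fin (size 0)) → x ≡ ∅
    -- ∅ is the unique minimal element: every element of positive rank covers something
    has-lower : ∀ n (y : Fin (size (suc n))) → ∃ (λ x → cover x y ≡ true)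
    D1 : ∀ n (u v : Fin (size n)) → u ≢ v → commonDown n u v ≡ commonUp n u v
    D2 : ∀ n (v : Fin (size n)) → upDeg n v ≡ suc (downDeg n v)

module MarkovChain (Γ : Graded) (D : IsDifferential1 Γ) where
  open Graded Γ
  open IsDifferential1 D

  bot : Elem
  bot = (0 , ∅)

  d∅ : Elem → ℕ
  d∅ x = d bot x

  trans : (r : ℕ) → Fin (size r) → Fin (size (suc r)) → ℚ
  trans r x y = if cover x y then frac (d∅ (suc r , y)) (suc r * d∅ (r , x)) else 0ℚ

  -- p(u,v): probability that the chain started at u ever visits v.
  -- Since every step raises the rank by one, v can only be visited at one time,
  -- so this is [u = v] + Σ_{w ↗ v} p(u,w) p_{w,v}.
  reachAt : Elem → (n : ℕ) → Fin (size n) → ℚ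
  reachAt u zero y    = if eqElem? u (zero , y) then 1ℚ else 0ℚ
  reachAt u (suc n) y = (if eqElem? u (suc n , y) then 1ℚ else 0ℚ)
                        +ℚ sumℚ (size n) (λ w → reachAt u n w *ℚ trans n w y)

  reach : Elem → Elem → ℚ
  reach u (n , y) = reachAt u n y

-- Every step raises the rank by one, so p(u, ·) on Γ_(n+1) is determined by its values on Γ_n:
-- p(u, y) = [u = y] + Σ_(w ↗ y) p(u, w) p_(w,y).  The closed form satisfies the same recursion:
-- in p(u, w) p_(w,y) the factor d(∅, w) cancels, leaving k!/(n+1)! · d(∅, y)/d(∅, u) · d(u, w),
-- and summing over w ↗ y reproduces the recursion d(u, y) = [u = y] + Σ_(w ↗ y) d(u, w) for
-- saturated chains.

module Submission where

open import Defs
open import Data.Nat using (ℕ; _!; _*_)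
open import Data.Fin using (Fin)
open import Data.Product using (_,_)
open import Relation.Binary.PropositionalEquality using (_≡_)

open import Data.Nat using (zero; suc; _+_; _≤_; _<_; z<s; NonZero; >-nonZero)
open import Data.Nat.Properties
  using (≤-trans; m≤m+n; m≤n+m; +-identityʳ; *-identityʳ; *-zeroʳ; *-distribˡ-+; *-distribʳ-+;
         m*n≢0; _!≢0; module ≤-Reasoning)
  renaming (_≟_ to _≟ℕ_)
open import Data.Nat.Tactic.RingSolver using (solve-∀)
open import Data.Fin using () renaming (zero to fzero; suc to fsuc; _≟_ to _≟F_)
open import Data.Bool using (true; false; if_then_else_)
open import Data.Product.Properties using (≡-dec)
open import Data.Integer as ℤ using (+_)
open import Data.Integer.Properties using (pos-+; pos-*)
open import Data.Rational using (ℚ; 0ℚ; 1ℚ; fromℚᵘ; toℚᵘ) renaming (_+_ to _+ℚ_; _*_ to _*ℚ_)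
open import Data.Rational.Properties
  using (toℚᵘ-injective; toℚᵘ-fromℚᵘ; fromℚᵘ-cong; toℚᵘ-homo-+; toℚᵘ-homo-*; /-cong; 0/n≡0)
  renaming (*-zeroʳ to *ℚ-zeroʳ)
open import Data.Rational.Unnormalised as ℚᵘ using (mkℚᵘ)
import Data.Rational.Unnormalised.Properties as ℚᵘ
open import Relation.Binary.PropositionalEquality
  using (refl; sym; trans; cong; cong₂; module ≡-Reasoning)
open import Relation.Nullary.Reflects using (Reflects; ofʸ; ofⁿ)
open import Relation.Nullary.Decidable using (yes; no)
open import Data.Empty using (⊥-elim)

fromℚᵘ-homo-+ : ∀ p q → fromℚᵘ (p ℚᵘ.+ q) ≡ fromℚᵘ p +ℚ fromℚᵘ q
fromℚᵘ-homo-+ p q = toℚᵘ-injective (begin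
  toℚᵘ (fromℚᵘ (p ℚᵘ.+ q))                ≈⟨ toℚᵘ-fromℚᵘ (p ℚᵘ.+ q) ⟩
  p ℚᵘ.+ q                                ≈⟨ ℚᵘ.+-cong (toℚᵘ-fromℚᵘ p) (toℚᵘ-fromℚᵘ q) ⟨
  toℚᵘ (fromℚᵘ p) ℚᵘ.+ toℚᵘ (fromℚᵘ q)    ≈⟨ toℚᵘ-homo-+ (fromℚᵘ p) (fromℚᵘ q) ⟨
  toℚᵘ (fromℚᵘ p +ℚ fromℚᵘ q)             ∎)
  where open ℚᵘ.≃-Reasoning

fromℚᵘ-homo-* : ∀ p q → fromℚᵘ (p ℚᵘ.* q) ≡ fromℚᵘ p *ℚ fromℚᵘ q
fromℚᵘ-homo-* p q = toℚᵘ-injective (begin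
  toℚᵘ (fromℚᵘ (p ℚᵘ.* q))                ≈⟨ toℚᵘ-fromℚᵘ (p ℚᵘ.* q) ⟩
  p ℚᵘ.* q                                ≈⟨ ℚᵘ.*-cong (toℚᵘ-fromℚᵘ p) (toℚᵘ-fromℚᵘ q) ⟨
  toℚᵘ (fromℚᵘ p) ℚᵘ.* toℚᵘ (fromℚᵘ q)    ≈⟨ toℚᵘ-homo-* (fromℚᵘ p) (fromℚᵘ q) ⟨
  toℚᵘ (fromℚᵘ p *ℚ fromℚᵘ q)             ∎)
  where open ℚᵘ.≃-Reasoning

frac-0 : ∀ b → frac 0 b ≡ 0ℚ
frac-0 zero    = refl
frac-0 (suc b) = 0/n≡0 (suc b)

frac-cross : ∀ a b c e .{{_ : NonZero b}} .{{_ : NonZero e}} →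
             a * e ≡ c * b → frac a b ≡ frac c e
frac-cross a (suc b) c (suc e) ae≡cb = fromℚᵘ-cong {mkℚᵘ (+ a) b} {mkℚᵘ (+ c) e} (ℚᵘ.*≡* (begin
  + a ℤ.* + suc e   ≡⟨ pos-* a (suc e) ⟨
  + (a * suc e)     ≡⟨ cong +_ ae≡cb ⟩
  + (c * suc b)     ≡⟨ pos-* c (suc b) ⟩
  + c ℤ.* + suc b   ∎))
  where open ≡-Reasoning

frac-+ : ∀ a b c e .{{_ : NonZero b}} .{{_ : NonZero e}} →
         frac a b +ℚ frac c e ≡ frac (a * e + c * b) (b * e)
frac-+ a (suc b) c (suc e) = begin
  frac a (suc b) +ℚ frac c (suc e)              ≡⟨ fromℚᵘ-homo-+ (mkℚᵘ (+ a) b) (mkℚᵘ (+ c) e) ⟨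
  fromℚᵘ (mkℚᵘ (+ a) b ℚᵘ.+ mkℚᵘ (+ c) e)       ≡⟨ /-cong numerator refl ⟩
  frac (a * suc e + c * suc b) (suc b * suc e)  ∎
  where
  open ≡-Reasoning
  numerator : + a ℤ.* + suc e ℤ.+ + c ℤ.* + suc b ≡ + (a * suc e + c * suc b)
  numerator = begin
    + a ℤ.* + suc e ℤ.+ + c ℤ.* + suc b   ≡⟨ cong₂ ℤ._+_ (pos-* a (suc e)) (pos-* c (suc b)) ⟨
    + (a * suc e) ℤ.+ + (c * suc b)       ≡⟨ pos-+ (a * suc e) (c * suc b) ⟨
    + (a * suc e + c * suc b)             ∎

frac-* : ∀ a b c e .{{_ : NonZero b}} .{{_ : NonZero e}} →
         frac a b *ℚ frac c e ≡ frac (a * c) (b * e)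
frac-* a (suc b) c (suc e) = begin
  frac a (suc b) *ℚ frac c (suc e)              ≡⟨ fromℚᵘ-homo-* (mkℚᵘ (+ a) b) (mkℚᵘ (+ c) e) ⟨
  fromℚᵘ (mkℚᵘ (+ a) b ℚᵘ.* mkℚᵘ (+ c) e)       ≡⟨ /-cong (pos-* a c) refl ⟨
  frac (a * c) (suc b * suc e)                  ∎
  where open ≡-Reasoning

frac-+-common : ∀ a c b .{{_ : NonZero b}} → frac a b +ℚ frac c b ≡ frac (a + c) b
frac-+-common a c b = trans (frac-+ a b c b)
  (frac-cross _ (b * b) _ b {{m*n≢0 b b}} (distrib a c b))
  where
  distrib : ∀ a c b → (a * b + c * b) * b ≡ (a + c) * (b * b)
  distrib = solve-∀

frac-self : ∀ a .{{_ : NonZero a}} → frac a a ≡ 1ℚ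
frac-self a = frac-cross a a 1 1 (trans (*-identityʳ a) (sym (+-identityʳ a)))

sumℚ-cong : ∀ m {f g : Fin m → ℚ} → (∀ i → f i ≡ g i) → sumℚ m f ≡ sumℚ m g
sumℚ-cong zero    f≗g = refl
sumℚ-cong (suc m) f≗g = cong₂ _+ℚ_ (f≗g fzero) (sumℚ-cong m (λ i → f≗g (fsuc i)))

sumℚ-frac : ∀ m (f : Fin m → ℕ) b .{{_ : NonZero b}} →
            sumℚ m (λ i → frac (f i) b) ≡ frac (sumℕ m f) b
sumℚ-frac zero    f b = sym (frac-0 b)
sumℚ-frac (suc m) f b = trans (cong (frac (f fzero) b +ℚ_) (sumℚ-frac m (λ i → f (fsuc i)) b))
                              (frac-+-common (f fzero) _ b)

sumℕ-*ˡ : ∀ m K (f : Fin m → ℕ) → sumℕ m (λ i → K * f i) ≡ K * sumℕ m f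
sumℕ-*ˡ zero    K f = sym (*-zeroʳ K)
sumℕ-*ˡ (suc m) K f = trans (cong (λ s → K * f fzero + s) (sumℕ-*ˡ m K (λ i → f (fsuc i))))
                            (sym (*-distribˡ-+ K (f fzero) _))

sumℕ-*ʳ : ∀ m Y (f : Fin m → ℕ) → sumℕ m (λ i → f i * Y) ≡ sumℕ m f * Y
sumℕ-*ʳ zero    Y f = refl
sumℕ-*ʳ (suc m) Y f = trans (cong (λ s → f fzero * Y + s) (sumℕ-*ʳ m Y (λ i → f (fsuc i))))
                            (sym (*-distribʳ-+ Y (f fzero) _))

term≤sumℕ : ∀ m (f : Fin m → ℕ) i → f i ≤ sumℕ m f
term≤sumℕ (suc m) f fzero    = m≤m+n (f fzero) _
term≤sumℕ (suc m) f (fsuc i) = ≤-trans (term≤sumℕ m (λ j → f (fsuc j)) i) (m≤n+m _ (f fzero))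

module _ (Γ : Graded) where
  open Graded Γ

  eqElem?-reflects : ∀ u v → Reflects (u ≡ v) (eqElem? u v)
  eqElem?-reflects u v with ≡-dec _≟ℕ_ _≟F_ u v
  ... | yes u≡v = ofʸ u≡v
  ... | no  u≢v = ofⁿ u≢v

module _ (Γ : Graded) (D : IsDifferential1 Γ) where
  open Graded Γ
  open IsDifferential1 D
  open MarkovChain Γ D renaming (trans to transition)

  d∅-positive : ∀ n x → 0 < d∅ (n , x)
  d∅-positive zero x with ∅-unique x
  ... | refl with eqElem? bot bot | eqElem?-reflects Γ bot bot
  ...   | _ | ofʸ _       = z<s
  ...   | _ | ofⁿ bot≢bot = ⊥-elim (bot≢bot refl)
  d∅-positive (suc n) y with has-lower n y
  ... | x , x↗y = begin-strict
    0                                  <⟨ d∅-positive n x ⟩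
    d∅ (n , x)                         ≡⟨ *-identityʳ (d∅ (n , x)) ⟨
    d∅ (n , x) * 1                     ≡⟨ cong (λ b → d∅ (n , x) * (if b then 1 else 0)) x↗y ⟨
    chain-through x                    ≤⟨ term≤sumℕ (size n) chain-through x ⟩
    sumℕ (size n) chain-through        ≤⟨ m≤n+m _ _ ⟩
    d∅ (suc n , y)                     ∎
    where
    open ≤-Reasoning
    chain-through : Fin (size n) → ℕ
    chain-through w = d∅ (n , w) * (if cover w y then 1 else 0)

  d∅≢0 : ∀ x → NonZero (d∅ x)
  d∅≢0 (n , x) = >-nonZero (d∅-positive n x)

  denominator≢0 : ∀ n u → NonZero (n ! * d∅ u)
  denominator≢0 n u = m*n≢0 (n !) (d∅ u) {{n !≢0}} {{d∅≢0 u}}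

  closedForm : Elem → (n : ℕ) → Fin (size n) → ℚ
  closedForm u n y = frac (rank u ! * chains u n y * d∅ (n , y)) (n ! * d∅ u)

  indicator-closedForm : ∀ u n y →
    (if eqElem? u (n , y) then 1ℚ else 0ℚ)
      ≡ frac (rank u ! * (if eqElem? u (n , y) then 1 else 0) * d∅ (n , y)) (n ! * d∅ u)
  indicator-closedForm u n y with eqElem? u (n , y) | eqElem?-reflects Γ u (n , y)
  ... | true  | ofʸ refl = sym (begin
    frac (n ! * 1 * Y) (n ! * Y)  ≡⟨ cong (λ m → frac (m * Y) (n ! * Y)) (*-identityʳ (n !)) ⟩
    frac (n ! * Y) (n ! * Y)      ≡⟨ frac-self (n ! * Y) ⟩
    1ℚ                            ∎)
    where
    open ≡-Reasoning
    Y : ℕ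
    Y = d∅ (n , y)
    instance _ = denominator≢0 n (n , y)
  ... | false | ofⁿ _    = sym (begin
    frac (rank u ! * 0 * Y) (n ! * d∅ u)  ≡⟨ cong (λ m → frac (m * Y) (n ! * d∅ u)) (*-zeroʳ (rank u !)) ⟩
    frac 0 (n ! * d∅ u)                   ≡⟨ frac-0 (n ! * d∅ u) ⟩
    0ℚ                                    ∎)
    where
    open ≡-Reasoning
    Y : ℕ
    Y = d∅ (n , y)

  closedForm-*-transition : ∀ u n w y →
    closedForm u n w *ℚ transition n w y
      ≡ frac (rank u ! * (chains u n w * (if cover w y then 1 else 0)) * d∅ (suc n , y)) (suc n ! * d∅ u)
  closedForm-*-transition u n w y with cover w y
  ... | false = begin
    closedForm u n w *ℚ 0ℚ               ≡⟨ *ℚ-zeroʳ (closedForm u n w) ⟩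
    0ℚ                                   ≡⟨ frac-0 den ⟨
    frac 0 den                           ≡⟨ cong (λ m → frac (m * Y) den) (*-zeroʳ K) ⟨
    frac (K * 0 * Y) den                 ≡⟨ cong (λ m → frac (K * m * Y) den) (*-zeroʳ c) ⟨
    frac (K * (c * 0) * Y) den           ∎
    where
    open ≡-Reasoning
    K c Y den : ℕ
    K = rank u !
    c = chains u n w
    Y = d∅ (suc n , y)
    den = suc n ! * d∅ u
  ... | true  = begin
    frac (K * c * Dw) (n ! * d∅ u) *ℚ frac Y (suc n * Dw)
      ≡⟨ frac-* (K * c * Dw) (n ! * d∅ u) Y (suc n * Dw) ⟩
    frac (K * c * Dw * Y) (n ! * d∅ u * (suc n * Dw))
      ≡⟨ frac-cross _ (n ! * d∅ u * (suc n * Dw)) _ (suc n ! * d∅ u) (cancel K c Dw Y n (n !) (d∅ u)) ⟩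
    frac (K * (c * 1) * Y) (suc n ! * d∅ u)  ∎
    where
    open ≡-Reasoning
    K c Y Dw : ℕ
    K = rank u !
    c = chains u n w
    Y = d∅ (suc n , y)
    Dw = d∅ (n , w)
    instance
      _ = denominator≢0 n u
      _ = denominator≢0 (suc n) u
      _ = m*n≢0 (suc n) Dw {{_}} {{d∅≢0 (n , w)}}
      _ = m*n≢0 (n ! * d∅ u) (suc n * Dw)
    cancel : ∀ K c Dw Y n N Du →
             K * c * Dw * Y * (suc n * N * Du) ≡ K * (c * 1) * Y * (N * Du * (suc n * Dw))
    cancel = solve-∀

  sum-closedForm-*-transition : ∀ u n y →
    sumℚ (size n) (λ w → closedForm u n w *ℚ transition n w y)
      ≡ frac (rank u ! * sumℕ (size n) (λ w → chains u n w * (if cover w y then 1 else 0)) * d∅ (suc n , y))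
             (suc n ! * d∅ u)
  sum-closedForm-*-transition u n y = begin
    sumℚ (size n) (λ w → closedForm u n w *ℚ transition n w y)
      ≡⟨ sumℚ-cong (size n) (λ w → closedForm-*-transition u n w y) ⟩
    sumℚ (size n) (λ w → frac (K * chain-through w * Y) den)
      ≡⟨ sumℚ-frac (size n) (λ w → K * chain-through w * Y) den ⟩
    frac (sumℕ (size n) (λ w → K * chain-through w * Y)) den
      ≡⟨ cong (λ s → frac s den) (sumℕ-*ʳ (size n) Y (λ w → K * chain-through w)) ⟩
    frac (sumℕ (size n) (λ w → K * chain-through w) * Y) den
      ≡⟨ cong (λ s → frac (s * Y) den) (sumℕ-*ˡ (size n) K chain-through) ⟩
    frac (K * sumℕ (size n) chain-through * Y) den  ∎
    where
    open ≡-Reasoning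
    K Y den : ℕ
    K = rank u !
    Y = d∅ (suc n , y)
    den = suc n ! * d∅ u
    chain-through : Fin (size n) → ℕ
    chain-through w = chains u n w * (if cover w y then 1 else 0)
    instance _ = denominator≢0 (suc n) u

  reachAt≡closedForm : ∀ u n y → reachAt u n y ≡ closedForm u n y
  reachAt≡closedForm u zero    y = indicator-closedForm u zero y
  reachAt≡closedForm u (suc n) y = begin
    reachAt u (suc n) y
      ≡⟨ cong (δ +ℚ_) (sumℚ-cong (size n) (λ w → cong (_*ℚ transition n w y) (reachAt≡closedForm u n w))) ⟩
    δ +ℚ sumℚ (size n) (λ w → closedForm u n w *ℚ transition n w y)
      ≡⟨ cong₂ _+ℚ_ (indicator-closedForm u (suc n) y) (sum-closedForm-*-transition u n y) ⟩
    frac (K * ι * Y) den +ℚ frac (K * Σ * Y) den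
      ≡⟨ frac-+-common (K * ι * Y) (K * Σ * Y) den ⟩
    frac (K * ι * Y + K * Σ * Y) den
      ≡⟨ cong (λ s → frac s den) (distrib K ι Σ Y) ⟩
    closedForm u (suc n) y  ∎
    where
    open ≡-Reasoning
    K Y den ι Σ : ℕ
    K = rank u !
    Y = d∅ (suc n , y)
    den = suc n ! * d∅ u
    ι = if eqElem? u (suc n , y) then 1 else 0
    Σ = sumℕ (size n) (λ w → chains u n w * (if cover w y then 1 else 0))
    δ : ℚ
    δ = if eqElem? u (suc n , y) then 1ℚ else 0ℚ
    instance _ = denominator≢0 (suc n) u
    distrib : ∀ K a b Y → K * a * Y + K * b * Y ≡ K * (a + b) * Y
    distrib = solve-∀

lemmaA3p2 : (Γ : Graded) (D : IsDifferential1 Γ) →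
    let open Graded Γ
        open MarkovChain Γ D
    in ∀ (k n : ℕ) (u : Fin (size k)) (v : Fin (size n)) →
       (k , u) ≤Γ (n , v) →
       reach (k , u) (n , v)
         ≡ frac (k ! * d (k , u) (n , v) * d∅ (n , v)) (n ! * d∅ (k , u))
lemmaA3p2 Γ D k n u v _ = reachAt≡closedForm Γ D (k , u) n v
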